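{- Let $P$ be a finite bounded poset, fix a total order $\Gamma: m_1,\dots,m_t$ on the maximal chains of $P$, and let $\lambda$ be the CE-labeling of $P$ determined by $\Gamma$ (as described in the context). Then: (i) Let $x\in P$, $x\neq\hat 1$, let $r$ be a root of $x$, and let $a_1,\dots,a_s$ be the atoms of $[x,\hat{1}]$ ordered by the index of the first chain of $\Gamma$ containing $r\cup\{a_j\}$. If $\lambda(r,x,a_k)=\lambda(r,x,a_l)$ with $k\le l$, then $\lambda(r,x,a_j)=\lambda(r,x,a_k)$ for all $j$ with $k\le j\le l$. (ii) If $m$ and $m'$ are maximal chains of the rooted interval $[x,\hat{1}]_r$ containing distinct atoms of $[x,\hat{1}]$, then the label sequences associated to $m$ and $m'$ are distinct. Further, if $P$ is not graded, then for any rooted interval $[x,y]_r$ and any distinct maximal chains $c,c'$ of $[x,y]_r$, the label sequence associated to $c$ is not a prefix of the label sequence associated to $c'$.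
   Context: A poset is bounded if it has a unique minimum $\hat{0}$ and maximum $\hat{1}$; graded means all maximal chains have equal length. $x\lessdot y$ denotes a cover relation. A root of $x$ is a maximal chain of $[\hat 0,x]$; a rooted interval $[x,y]_r$ is an interval with a root $r$ of $x$; a rooted cover relation $(r,x,u)$ is $[x,u]_r$ with $x\lessdot u$. A CE-labeling assigns a label $\lambda(r,x,u)$ to each rooted cover relation. The label sequence of a maximal chain $x=x_0\lessdot x_1\lessdot\cdots\lessdot x_t=y$ of $[x,y]_r$ is $(\lambda(r,x_0,x_1),\lambda(r\cup\{x_1\},x_1,x_2),\dots,\lambda(r\cup\{x_1,\dots,x_{t-1}\},x_{t-1},x_t))$. The CE-labeling determined by $\Gamma$: for $x\ne\hat1$ and a root $r$ of $x$, list the atoms $a_1,\dots,a_s$ of $[x,\hat{1}]$ in the order in which they first appear together with $r$ in a maximal chain of $\Gamma$, and let $i_j$ be the index of the earliest chain $m_{i_j}$ of $\Gamma$ containing $r\cup\{a_j\}$. Set $\lambda(r,x,a_1)=i_1$. Having labeled $x\lessdot a_1,\dots,x\lessdot a_{j-1}$: if there is an atom $a_h$ with $h<j$ such that $r\cup\{a_h\}$ is contained in maximal chains $m_k$ and $m_l$ with $k<i_j<l$, set $\lambda(r,x,a_j)=\lambda(r,x,a_h)$ (for such an $h$); otherwise set $\lambda(r,x,a_j)=i_j$. -}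

module Defs where

open import Level using (0ℓ)
open import Data.Nat using (ℕ; suc; _≤_)
open import Data.Fin using (Fin; toℕ)
open import Data.List using (List; []; _∷_; _++_; length)
open import Data.List.Relation.Binary.Subset.Propositional using (_⊆_)
open import Data.List.Relation.Binary.Prefix.Heterogeneous using (Prefix)
open import Data.Product using (Σ; ∃; _×_; _,_)
open import Data.Sum using (_⊎_)
open import Data.Empty using (⊥)
open import Relation.Nullary using (¬_)
open import Relation.Binary.PropositionalEquality using (_≡_; _≢_)
open import Relation.Binary.Structures using (IsPartialOrder)
open import Function.Definitions using (Injective)

record FinBoundedPoset : Set₁ where
  field
    n              : ℕ
    _≼_            : Fin n → Fin n → Set
    isPartialOrder : IsPartialOrder _≡_ _≼_
    bot            : Fin n
    top            : Fin n
    bot-min        : ∀ x → bot ≼ x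
    top-max        : ∀ x → x ≼ top

module _ (P : FinBoundedPoset) where
  open FinBoundedPoset P

  El : Set
  El = Fin n

  _≺_ : El → El → Set
  x ≺ y = x ≼ y × x ≢ y

  _⋖_ : El → El → Set
  x ⋖ y = x ≺ y × (∀ z → x ≺ z → z ≺ y → ⊥)

  -- Sat x y c : c = (x = x₀ ⋖ x₁ ⋖ ⋯ ⋖ x_t = y), listed from x up to y;
  -- i.e. c is a maximal chain of the interval [x,y].
  data Sat : El → El → List El → Set where
    single : ∀ {x} → Sat x x (x ∷ [])
    step   : ∀ {x y z c} → x ⋖ y → Sat y z c → Sat x z (x ∷ c)

  MaxChain : List El → Set
  MaxChain c = Sat bot top c

  Root : List El → El → Set
  Root r x = Sat bot x r

  Graded : Set
  Graded = ∀ c c' → MaxChain c → MaxChain c' → length c ≡ length c'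

  -- a total order Γ : m₁,…,m_t on the maximal chains of P
  -- (m_{i+1} = chain (i : Fin t), so Γ-index of (i : Fin t) is suc (toℕ i))
  record ChainOrder : Set where
    field
      t        : ℕ
      chain    : Fin t → List El
      chain-max : ∀ i → MaxChain (chain i)
      chain-inj : Injective _≡_ _≡_ chain
      chain-all : ∀ c → MaxChain c → ∃ λ i → chain i ≡ c

  -- A CE-labeling: a label for each rooted cover relation (r, x, u)
  -- (the function is total, only its values on rooted cover relations matter).
  Labeling : Set
  Labeling = List El → El → El → ℕ

  labelSeq : Labeling → List El → List El → List ℕ
  labelSeq λ' r (x ∷ y ∷ c) = λ' r x y ∷ labelSeq λ' (r ++ (y ∷ [])) (y ∷ c)
  labelSeq λ' r _ = []

  module _ (Γ : ChainOrder) where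
    open ChainOrder Γ

    InChain : List El → El → Fin t → Set
    InChain r a k = (a ∷ r) ⊆ chain k

    FirstIndex : List El → El → Fin t → Set
    FirstIndex r a k = InChain r a k × (∀ k' → toℕ k' Data.Nat.< toℕ k → ¬ InChain r a k')

    Straddles : List El → El → Fin t → El → Set
    Straddles r x i b =
      x ⋖ b × (Σ (Fin t) λ ib → FirstIndex r b ib × toℕ ib Data.Nat.< toℕ i)
      × (Σ (Fin t) λ k → Σ (Fin t) λ l →
           toℕ k Data.Nat.< toℕ i × toℕ i Data.Nat.< toℕ l × InChain r b k × InChain r b l)

    -- λ is the CE-labeling determined by Γ (labels are the 1-based Γ-indices)
    IsDeterminedBy : Labeling → Set
    IsDeterminedBy λ' =
      ∀ x r a i → x ≢ top → Root r x → x ⋖ a → FirstIndex r a i →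
        (Σ El λ b → Straddles r x i b × λ' r x a ≡ λ' r x b)
        ⊎ ((¬ Σ El λ b → Straddles r x i b) × λ' r x a ≡ suc (toℕ i))

module Submission where

-- Unwinding the labeling rule, the label of an atom a with first index i is copied from an
-- earlier straddling atom, then from an earlier one, and so on, until it reaches an atom whose
-- label is its own first index o (the origin of a).  No atom straddles o, while every index in
-- (o , i] is bridged by an atom whose chains reach past it.  Equal labels mean equal origins, and
-- an atom between ak and al with a different origin would put one origin inside the bridged
-- range of another, i.e. make it straddled: this is (i).
-- Since an origin is the first index of an atom above the root, every label is the Γ-index of a
-- maximal chain through the root.  Two chains of [x,y]_r leaving x by different atoms a ≠ a' thus
-- cannot share their second label, or a and a' would lie on one maximal chain; this gives (ii).

open import Defs
open import Data.Nat using (ℕ; _≤_; suc; _<_; s≤s; _≤?_)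
open import Data.Nat.Properties using (≤-trans; ≤-refl; <⇒≤; ≰⇒>; <-≤-trans; ≤-<-trans; <-cmp; suc-injective; <-irrefl)
open import Data.Fin using (Fin; toℕ; zero; suc; _≟_)
open import Data.Fin.Properties using (toℕ-injective)
open import Data.Fin.Induction using (po-wellFounded; po-noetherian; <-wellFounded)
open import Induction.WellFounded using (Acc; acc)
open import Data.List using (List; _∷_; _++_; [_])
open import Data.List.Membership.Propositional using (_∈_)
open import Data.List.Membership.Propositional.Properties using (∈-++⁺ˡ; ∈-++⁺ʳ)
open import Data.List.Relation.Unary.Any using (here; there)
open import Data.List.Relation.Binary.Subset.Propositional using (_⊆_)
open import Data.List.Relation.Binary.Pointwise using (≡⇒Pointwise-≡)
open import Data.List.Relation.Binary.Prefix.Heterogeneous using (Prefix; _∷_)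
open import Data.List.Relation.Binary.Prefix.Heterogeneous.Properties using (fromPointwise)
open import Data.Product using (_×_; Σ; _,_; proj₁; proj₂)
open import Data.Sum using (_⊎_; inj₁; inj₂)
open import Data.Empty using (⊥; ⊥-elim)
open import Effect.Monad using (RawMonad)
open import Level using (0ℓ)
open import Relation.Nullary using (¬_; yes; no)
open import Relation.Nullary.Negation using (DoubleNegation; ¬¬-Monad)
open import Relation.Nullary.Decidable using (¬¬-excluded-middle)
open import Relation.Unary using (Decidable)
open import Relation.Binary.PropositionalEquality using (_≡_; _≢_; refl; sym; trans; cong; subst; subst₂)
open import Relation.Binary.Structures using (IsPartialOrder)
open import Relation.Binary.Definitions using (tri<; tri≈; tri>)

open RawMonad (¬¬-Monad {a = 0ℓ})

least-witness : ∀ {m} (Q : Fin m → Set) → Decidable Q → ∀ k → Q k →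
                Σ (Fin m) λ i → Q i × (∀ j → toℕ j < toℕ i → ¬ Q j)
least-witness Q Q? zero qk = zero , qk , λ j ()
least-witness Q Q? (suc k) qk with Q? zero
... | yes q0 = zero , q0 , λ j ()
... | no ¬q0 with least-witness (λ i → Q (suc i)) (λ i → Q? (suc i)) k qk
...   | i , qi , least = suc i , qi , λ { zero _ → ¬q0 ; (suc j) (s≤s j<i) → least j j<i }

module SaturatedChains (P : FinBoundedPoset) where
  open FinBoundedPoset P
  module ≼ = IsPartialOrder isPartialOrder

  infix 4 _⋖′_ _≺′_

  _⋖′_ : El P → El P → Set
  _⋖′_ = _⋖_ P

  _≺′_ : El P → El P → Set
  _≺′_ = _≺_ P

  ⋖⇒≼ : ∀ {x y} → x ⋖′ y → x ≼ y
  ⋖⇒≼ x⋖y = proj₁ (proj₁ x⋖y)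

  ⋖⇒⋡ : ∀ {x y} → x ⋖′ y → ¬ y ≼ x
  ⋖⇒⋡ x⋖y y≼x = proj₂ (proj₁ x⋖y) (≼.antisym (⋖⇒≼ x⋖y) y≼x)

  ⋖⇒≢top : ∀ {x y} → x ⋖′ y → x ≢ top
  ⋖⇒≢top {y = y} x⋖y refl = ⋖⇒⋡ x⋖y (top-max y)

  covers-≼⇒≡ : ∀ {x a a'} → x ⋖′ a → x ⋖′ a' → a ≼ a' → a ≡ a'
  covers-≼⇒≡ {a = a} {a'} x⋖a x⋖a' a≼a' with a ≟ a'
  ... | yes a≡a' = a≡a'
  ... | no a≢a' = ⊥-elim (proj₂ x⋖a' a (proj₁ x⋖a) (a≼a' , a≢a'))

  Sat⇒≼ : ∀ {u v c} → Sat P u v c → u ≼ v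
  Sat⇒≼ single = ≼.refl
  Sat⇒≼ (step u⋖ s) = ≼.trans (⋖⇒≼ u⋖) (Sat⇒≼ s)

  Sat⇒start∈ : ∀ {u v c} → Sat P u v c → u ∈ c
  Sat⇒start∈ single = here refl
  Sat⇒start∈ (step _ _) = here refl

  Sat-∈⇒≽start : ∀ {u v c e} → Sat P u v c → e ∈ c → u ≼ e
  Sat-∈⇒≽start single (here refl) = ≼.refl
  Sat-∈⇒≽start (step u⋖ s) (here refl) = ≼.refl
  Sat-∈⇒≽start (step u⋖ s) (there e∈) = ≼.trans (⋖⇒≼ u⋖) (Sat-∈⇒≽start s e∈)

  Sat-comparable : ∀ {u v c e e'} → Sat P u v c → e ∈ c → e' ∈ c → e ≼ e' ⊎ e' ≼ e
  Sat-comparable single (here refl) (here refl) = inj₁ ≼.refl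
  Sat-comparable (step u⋖ s) (here refl) (here refl) = inj₁ ≼.refl
  Sat-comparable (step u⋖ s) (here refl) (there e'∈) = inj₁ (Sat-∈⇒≽start (step u⋖ s) (there e'∈))
  Sat-comparable (step u⋖ s) (there e∈) (here refl) = inj₂ (Sat-∈⇒≽start (step u⋖ s) (there e∈))
  Sat-comparable (step u⋖ s) (there e∈) (there e'∈) = Sat-comparable s e∈ e'∈

  Sat-covers-unique : ∀ {u v c x a a'} → Sat P u v c → a ∈ c → a' ∈ c →
                      x ⋖′ a → x ⋖′ a' → a ≡ a'
  Sat-covers-unique s a∈ a'∈ x⋖a x⋖a' with Sat-comparable s a∈ a'∈
  ... | inj₁ a≼a' = covers-≼⇒≡ x⋖a x⋖a' a≼a'
  ... | inj₂ a'≼a = sym (covers-≼⇒≡ x⋖a' x⋖a a'≼a)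

  Sat-snoc : ∀ {u v w c} → Sat P u v c → v ⋖′ w → Sat P u w (c ++ [ w ])
  Sat-snoc single v⋖w = step v⋖w single
  Sat-snoc (step u⋖ s) v⋖w = step u⋖ (Sat-snoc s v⋖w)

  Sat-++ : ∀ {u v w c d} → Sat P u v c → Sat P v w (v ∷ d) → Sat P u w (c ++ d)
  Sat-++ single s' = s'
  Sat-++ (step u⋖ s) s' = step u⋖ (Sat-++ s s')

  -- The order is not decidable, so covers and saturated chains are only found classically.
  ¬¬cover-below : ∀ {u} z → u ≺′ z → Acc _≺′_ z → DoubleNegation (Σ (El P) (u ⋖′_))
  ¬¬cover-below {u} z u≺z (acc below) =
    ¬¬-excluded-middle {A = Σ (El P) λ w → u ≺′ w × w ≺′ z} >>= λ where
      (yes (w , u≺w , w≺z)) → ¬¬cover-below w u≺w (below w≺z)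
      (no none) → pure (z , u≺z , λ w u≺w w≺z → none (w , u≺w , w≺z))

  ¬¬Sat-to-top : ∀ u → Acc (λ a b → b ≺′ a) u → DoubleNegation (Σ (List (El P)) (Sat P u top))
  ¬¬Sat-to-top u (acc above) with u ≟ top
  ... | yes refl = pure (_ , single)
  ... | no u≢top = do
    (v , u⋖v) ← ¬¬cover-below top (top-max u , u≢top) (po-wellFounded isPartialOrder top)
    (c , s) ← ¬¬Sat-to-top v (above (proj₁ u⋖v))
    pure (u ∷ c , step u⋖v s)

module DeterminedLabeling (P : FinBoundedPoset) (Γ : ChainOrder P) (λ' : Labeling P)
                          (determined : IsDeterminedBy P Γ λ') where
  open FinBoundedPoset P
  open ChainOrder Γ
  open SaturatedChains P
  open import Data.List.Relation.Binary.Subset.DecPropositional (_≟_ {n}) using (_⊆?_)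

  Bridged : List (El P) → El P → ℕ → Set
  Bridged r x j = Σ (El P) λ b → Σ (Fin t) λ ib → Σ (Fin t) λ l →
    x ⋖′ b × FirstIndex P Γ r b ib × toℕ ib < j × j < toℕ l × InChain P Γ r b l

  Bridged⇒Straddles : ∀ {r x} i → Bridged r x (toℕ i) → Σ (El P) (Straddles P Γ r x i)
  Bridged⇒Straddles i (b , ib , l , x⋖b , first-b , ib<i , i<l , b∈l) =
    b , x⋖b , (ib , first-b , ib<i) , (ib , l , ib<i , i<l , proj₁ first-b , b∈l)

  record Origin (r : List (El P)) (x a : El P) (i : Fin t) : Set where
    field
      origin      : Fin t
      label≡      : λ' r x a ≡ suc (toℕ origin)
      origin≤     : toℕ origin ≤ toℕ i
      unstraddled : ¬ Σ (El P) (Straddles P Γ r x origin)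
      bridged     : ∀ j → toℕ origin < j → j ≤ toℕ i → Bridged r x j
      root⊆       : r ⊆ chain origin
  open Origin

  origin-acc : ∀ {r x a i} → x ≢ top → Root P r x → x ⋖′ a → FirstIndex P Γ r a i →
               Acc Data.Fin._<_ i → Origin r x a i
  origin-acc {r} {x} {a} {i} x≢top root x⋖a first-a (acc earlier)
    with determined x r a i x≢top root x⋖a first-a
  ... | inj₂ (none , label≡) = record
    { origin = i ; label≡ = label≡ ; origin≤ = ≤-refl ; unstraddled = none
    ; bridged = λ j i<j j≤i → ⊥-elim (<-irrefl refl (<-≤-trans i<j j≤i))
    ; root⊆ = λ e∈r → proj₁ first-a (there e∈r) }
  ... | inj₁ (b , (x⋖b , (ib , first-b , ib<i) , (_ , l , _ , i<l , _ , b∈l)) , copied) = record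
    { origin = origin O ; label≡ = trans copied (label≡ O)
    ; origin≤ = ≤-trans (origin≤ O) (<⇒≤ ib<i) ; unstraddled = unstraddled O
    ; bridged = bridged′ ; root⊆ = root⊆ O }
    where
      O : Origin r x b ib
      O = origin-acc x≢top root x⋖b first-b (earlier ib<i)

      bridged′ : ∀ j → toℕ (origin O) < j → j ≤ toℕ i → Bridged r x j
      bridged′ j o<j j≤i with j ≤? toℕ ib
      ... | yes j≤ib = bridged O j o<j j≤ib
      ... | no j≰ib = b , ib , l , x⋖b , first-b , ≰⇒> j≰ib , ≤-<-trans j≤i i<l , b∈l

  origin-of : ∀ {r x a i} → x ≢ top → Root P r x → x ⋖′ a → FirstIndex P Γ r a i → Origin r x a i
  origin-of x≢top root x⋖a first-a = origin-acc x≢top root x⋖a first-a (<-wellFounded _)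

  origin-outside-bridged : ∀ {r x a a' i i'} (O : Origin r x a i) (O' : Origin r x a' i') →
                           toℕ (origin O) < toℕ (origin O') → toℕ (origin O') ≤ toℕ i → ⊥
  origin-outside-bridged O O' o<o' o'≤i =
    unstraddled O' (Bridged⇒Straddles (origin O') (bridged O (toℕ (origin O')) o<o' o'≤i))

  labels-constant-between : ∀ x r ak al aj ik il ij → x ≢ top → Root P r x →
    x ⋖′ ak → FirstIndex P Γ r ak ik →
    x ⋖′ al → FirstIndex P Γ r al il →
    x ⋖′ aj → FirstIndex P Γ r aj ij →
    toℕ ik ≤ toℕ il → λ' r x ak ≡ λ' r x al →
    toℕ ik ≤ toℕ ij → toℕ ij ≤ toℕ il → λ' r x aj ≡ λ' r x ak
  labels-constant-between x r ak al aj ik il ij x≢top root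
                          x⋖ak first-k x⋖al first-l x⋖aj first-j _ k≡l ik≤ij ij≤il =
    trans (label≡ Oj) (trans (cong suc oj≡ok) (sym (label≡ Ok)))
    where
      Ok = origin-of x≢top root x⋖ak first-k
      Ol = origin-of x≢top root x⋖al first-l
      Oj = origin-of x≢top root x⋖aj first-j

      ok≡ol : toℕ (origin Ok) ≡ toℕ (origin Ol)
      ok≡ol = suc-injective (trans (sym (label≡ Ok)) (trans k≡l (label≡ Ol)))

      oj≡ok : toℕ (origin Oj) ≡ toℕ (origin Ok)
      oj≡ok with <-cmp (toℕ (origin Oj)) (toℕ (origin Ok))
      ... | tri≈ _ oj≡ok _ = oj≡ok
      ... | tri< oj<ok _ _ = ⊥-elim (origin-outside-bridged Oj Ok oj<ok (≤-trans (origin≤ Ok) ik≤ij))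
      ... | tri> _ _ ok<oj = ⊥-elim (origin-outside-bridged Ol Oj
              (subst (_< toℕ (origin Oj)) ok≡ol ok<oj) (≤-trans (origin≤ Oj) ij≤il))

  ¬¬first-index : ∀ {r x u} → Root P r x → x ⋖′ u → DoubleNegation (Σ (Fin t) (FirstIndex P Γ r u))
  ¬¬first-index {r} {x} {u} root x⋖u = do
    (c , s) ← ¬¬Sat-to-top u (po-noetherian isPartialOrder u)
    let (k , chain-k) = chain-all (r ++ c) (Sat-++ root (step x⋖u s))
        u∷r⊆k : InChain P Γ r u k
        u∷r⊆k = λ where
          (here refl) → subst (u ∈_) (sym chain-k) (∈-++⁺ʳ r (Sat⇒start∈ s))
          (there e∈r) → subst (_ ∈_) (sym chain-k) (∈-++⁺ˡ e∈r)
    pure (least-witness (InChain P Γ r u) (λ i → (u ∷ r) ⊆? chain i) k u∷r⊆k)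

  ¬¬label-chain : ∀ {r x u} → Root P r x → x ⋖′ u →
                  DoubleNegation (Σ (Fin t) λ i → λ' r x u ≡ suc (toℕ i) × r ⊆ chain i)
  ¬¬label-chain root x⋖u = do
    (i , first-u) ← ¬¬first-index root x⋖u
    let O = origin-of (⋖⇒≢top x⋖u) root x⋖u first-u
    pure (origin O , label≡ O , λ {_} → root⊆ O)

  next-labels-distinct : ∀ {r x a a' b b'} → Root P r x → x ⋖′ a → x ⋖′ a' → a ≢ a' →
                         a ⋖′ b → a' ⋖′ b' → λ' (r ++ [ a ]) a b ≢ λ' (r ++ [ a' ]) a' b'
  next-labels-distinct {r} {a' = a'} root x⋖a x⋖a' a≢a' a⋖b a'⋖b' labels≡ =
    ¬¬label-chain (Sat-snoc root x⋖a) a⋖b λ (i , label≡ , ⊆i) →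
    ¬¬label-chain (Sat-snoc root x⋖a') a'⋖b' λ (i' , label≡' , ⊆i') →
    let i≡i' = toℕ-injective (suc-injective (trans (sym label≡) (trans labels≡ label≡')))
    in a≢a' (Sat-covers-unique (chain-max i) (⊆i (∈-++⁺ʳ r (here refl)))
              (subst (λ k → a' ∈ chain k) (sym i≡i') (⊆i' (∈-++⁺ʳ r (here refl)))) x⋖a x⋖a')

  labelSeq-∷ : ∀ r x {a y c} → Sat P a y c →
               labelSeq P λ' r (x ∷ c) ≡ λ' r x a ∷ labelSeq P λ' (r ++ [ a ]) c
  labelSeq-∷ r x single = refl
  labelSeq-∷ r x (step _ _) = refl

  -- If one of the two chains is the single cover x ⋖ y, the other atom lies below y and so is y.
  branching-not-prefix : ∀ {r x y a a' c c'} → Root P r x →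
    x ⋖′ a → Sat P a y c → x ⋖′ a' → Sat P a' y c' → a ≢ a' →
    ¬ Prefix _≡_ (labelSeq P λ' r (x ∷ c)) (labelSeq P λ' r (x ∷ c'))
  branching-not-prefix root x⋖a single x⋖a' s' a≢a' _ =
    a≢a' (sym (covers-≼⇒≡ x⋖a' x⋖a (Sat⇒≼ s')))
  branching-not-prefix root x⋖a (step a⋖ s) x⋖a' single a≢a' _ =
    a≢a' (covers-≼⇒≡ x⋖a x⋖a' (Sat⇒≼ (step a⋖ s)))
  branching-not-prefix {r} {a = a} {a'} root x⋖a (step a⋖b s) x⋖a' (step a'⋖b' s') a≢a' (_ ∷ prefix)
    with subst₂ (Prefix _≡_) (labelSeq-∷ (r ++ [ a ]) a s) (labelSeq-∷ (r ++ [ a' ]) a' s') prefix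
  ... | labels≡ ∷ _ = next-labels-distinct root x⋖a x⋖a' a≢a' a⋖b a'⋖b' labels≡

  labelSeq-not-prefix : ∀ {x y r c c'} → Root P r x → Sat P x y c → Sat P x y c' → c ≢ c' →
                        ¬ Prefix _≡_ (labelSeq P λ' r c) (labelSeq P λ' r c')
  labelSeq-not-prefix root single single c≢c' _ = c≢c' refl
  labelSeq-not-prefix root single (step x⋖ s) _ _ = ⋖⇒⋡ x⋖ (Sat⇒≼ s)
  labelSeq-not-prefix root (step x⋖ s) single _ _ = ⋖⇒⋡ x⋖ (Sat⇒≼ s)
  labelSeq-not-prefix {x} {r = r} root (step {y = a} x⋖a s) (step {y = a'} x⋖a' s') c≢c' prefix
    with a ≟ a'
  ... | no a≢a' = branching-not-prefix root x⋖a s x⋖a' s' a≢a' prefix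
  ... | yes refl with subst₂ (Prefix _≡_) (labelSeq-∷ r x s) (labelSeq-∷ r x s') prefix
  ...   | _ ∷ prefix′ = labelSeq-not-prefix (Sat-snoc root x⋖a) s s' (λ c≡ → c≢c' (cong (x ∷_) c≡)) prefix′

  labelSeq-injective-on-atoms : ∀ x r m m' a a' → Root P r x → Sat P x top m → Sat P x top m' →
    x ⋖′ a → a ∈ m → x ⋖′ a' → a' ∈ m' → a ≢ a' → labelSeq P λ' r m ≢ labelSeq P λ' r m'
  labelSeq-injective-on-atoms x r m m' a a' root s s' x⋖a a∈m x⋖a' a'∈m' a≢a' labels≡ =
    labelSeq-not-prefix root s s' m≢m' (fromPointwise (≡⇒Pointwise-≡ labels≡))
    where
      m≢m' : m ≢ m'
      m≢m' m≡m' = a≢a' (Sat-covers-unique s a∈m (subst (a' ∈_) (sym m≡m') a'∈m') x⋖a x⋖a')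

proposition4p4 : (P : FinBoundedPoset) (Γ : ChainOrder P) (λ' : Labeling P) →
    IsDeterminedBy P Γ λ' →
    (∀ x r ak al aj ik il ij → x ≢ FinBoundedPoset.top P → Root P r x →
    _⋖_ P x ak → FirstIndex P Γ r ak ik →
    _⋖_ P x al → FirstIndex P Γ r al il →
    _⋖_ P x aj → FirstIndex P Γ r aj ij →
    toℕ ik ≤ toℕ il → λ' r x ak ≡ λ' r x al →
    toℕ ik ≤ toℕ ij → toℕ ij ≤ toℕ il → λ' r x aj ≡ λ' r x ak)
    ×
    (∀ x r m m' a a' → Root P r x →
    Sat P x (FinBoundedPoset.top P) m → Sat P x (FinBoundedPoset.top P) m' →
    _⋖_ P x a → a ∈ m → _⋖_ P x a' → a' ∈ m' → a ≢ a' →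
    labelSeq P λ' r m ≢ labelSeq P λ' r m')
    ×
    (¬ Graded P → ∀ x y r c c' → Root P r x → Sat P x y c → Sat P x y c' → c ≢ c' →
    ¬ Prefix _≡_ (labelSeq P λ' r c) (labelSeq P λ' r c'))
proposition4p4 P Γ λ' determined =
  labels-constant-between , labelSeq-injective-on-atoms , λ _ x y r c c' → labelSeq-not-prefix
  where open DeterminedLabeling P Γ λ' determined
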